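{- For all integers $n\ge1$ and $k\ge1$, $\mathfrak B_{2n}^{(-k)}\equiv 0\pmod 6$.
   Context: For an integer $k$, the poly-Bernoulli numbers with level $2$, $\mathfrak B_n^{(k)}$, are defined by the power series identity $$\sum_{n=0}^\infty\mathfrak B_n^{(k)}\frac{x^n}{n!}=\frac{{\rm Li}_{2,k}\bigl(2\sin(x/2)\bigr)}{2\sin(x/2)}=\sum_{m=0}^\infty\frac{\bigl(2\sin(x/2)\bigr)^{2m}}{(2m+1)^k},$$ where ${\rm Li}_{2,k}(z)=\sum_{n=0}^\infty\frac{z^{2n+1}}{(2n+1)^k}$. For $k\le 0$ these numbers are integers. -}

module Defs where

open import Data.Nat as ℕ using (ℕ; zero; suc)
open import Data.Nat.Combinatorics using (_C_)
open import Data.Integer as ℤ using (ℤ; +_; -_; _+_; _*_; _-_; _^_)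

-- Exponential generating functions with integer coefficients:
-- a sequence f represents the power series  Σ f n · xⁿ / n!.
EGF : Set
EGF = ℕ → ℤ

sumTo : ℕ → (ℕ → ℤ) → ℤ
sumTo zero    f = f 0
sumTo (suc n) f = sumTo n f + f (suc n)

egfMul : EGF → EGF → EGF
egfMul f g n = sumTo n (λ i → (+ (n C i)) * (f i * g (n ℕ.∸ i)))

egfOne : EGF
egfOne zero    = + 1
egfOne (suc _) = + 0

egfPow : EGF → ℕ → EGF
egfPow f zero    = egfOne
egfPow f (suc m) = egfMul f (egfPow f m)

cosE : EGF
cosE zero          = + 1
cosE (suc zero)    = + 0
cosE (suc (suc n)) = - cosE n

-- (2 sin(x/2))² = 2 - 2 cos x
sin2sq : EGF
sin2sq zero    = + 2 - + 2 * cosE zero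
sin2sq (suc n) = - (+ 2 * cosE (suc n))

-- Poly-Bernoulli numbers of level 2 with negative index:
--   polyBernoulli2Neg n k = 𝔅ₙ^(-k) = n! [xⁿ] Σ_m (2m+1)^k (2 sin(x/2))^{2m}.
-- Since (2 sin(x/2))^{2m} = x^{2m} + O(x^{2m+2}), only m ≤ n contribute
-- to the coefficient of xⁿ, so the sum over m may be truncated at n.
polyBernoulli2Neg : ℕ → ℕ → ℤ
polyBernoulli2Neg n k =
  sumTo n (λ m → ((+ (2 ℕ.* m ℕ.+ 1)) ^ k) * egfPow sin2sq m n)

{-# OPTIONS --safe #-}
-- With s = (2 sin(x/2))² = 2 − 2 cos x, the identity cos² x = (1 + cos 2x)/2 gives
-- s² = 6 − 8 cos x + 2 cos 2x, whose coefficient of xⁿ for n ≥ 1 is 4 (2ⁿ⁻¹ − 2) cos⁽ⁿ⁾(0).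
-- It vanishes for odd n and is divisible by 3 for even n, so 6 divides every coefficient of
-- sᵐ for m ≥ 2.  In 𝔅_N^(−k) = Σ_m (2m+1)^k N! [x^N] sᵐ with N ≥ 1, the term m = 0 is zero and
-- the term m = 1 is 3^k times an even coefficient of s, so 6 ∣ 𝔅_N^(−k) for every N ≥ 1, k ≥ 1.
module Submission where

open import Defs
open import Data.Nat using (ℕ; _≤_; _*_)
open import Data.Integer using (+_)
open import Data.Integer.Divisibility using (_∣_)

open import Data.Nat as ℕ using (zero; suc; z≤n; s≤s)
open import Data.Nat.Properties
  using (≤-refl; m≤n⇒m≤1+n; m≤n⇒m<n∨m≡n; n<1+n; +-suc; +-identityʳ; n∸n≡0; +-∸-assoc)
open import Data.Nat.Combinatorics using (_C_; nCn≡1; nCk+nC[k+1]≡[n+1]C[k+1])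
open import Data.Nat.Combinatorics.Specification using (k>n⇒nCk≡0)
open import Data.Integer using (ℤ; -_; _+_; _-_; _^_) renaming (_*_ to _·_)
import Data.Integer.Properties as ℤ
import Data.Integer.Divisibility.Signed as Signed
open import Data.Integer.Tactic.RingSolver using (solve-∀)
open import Data.Sum using (inj₁; inj₂)
open import Relation.Binary.PropositionalEquality
  using (_≡_; refl; sym; trans; cong; cong₂; subst; module ≡-Reasoning)

sumTo-cong : ∀ n {f g : ℕ → ℤ} → (∀ i → i ≤ n → f i ≡ g i) → sumTo n f ≡ sumTo n g
sumTo-cong zero    f≗g = f≗g 0 z≤n
sumTo-cong (suc n) f≗g =
  cong₂ _+_ (sumTo-cong n (λ i i≤n → f≗g i (m≤n⇒m≤1+n i≤n))) (f≗g (suc n) ≤-refl)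

sumTo-+ : ∀ n (f g : ℕ → ℤ) → sumTo n (λ i → f i + g i) ≡ sumTo n f + sumTo n g
sumTo-+ zero    f g = refl
sumTo-+ (suc n) f g rewrite sumTo-+ n f g =
  interchange (sumTo n f) (sumTo n g) (f (suc n)) (g (suc n))
  where
  interchange : ∀ a b c d → (a + b) + (c + d) ≡ (a + c) + (b + d)
  interchange = solve-∀

sumTo-- : ∀ n (f g : ℕ → ℤ) → sumTo n (λ i → f i - g i) ≡ sumTo n f - sumTo n g
sumTo-- zero    f g = refl
sumTo-- (suc n) f g rewrite sumTo-- n f g =
  interchange (sumTo n f) (sumTo n g) (f (suc n)) (g (suc n))
  where
  interchange : ∀ a b c d → (a - b) + (c - d) ≡ (a + c) - (b + d)
  interchange = solve-∀

sumTo-*ˡ : ∀ n a (f : ℕ → ℤ) → sumTo n (λ i → a · f i) ≡ a · sumTo n f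
sumTo-*ˡ zero    a f = refl
sumTo-*ˡ (suc n) a f rewrite sumTo-*ˡ n a f = sym (ℤ.*-distribˡ-+ a (sumTo n f) (f (suc n)))

sumTo-suc : ∀ n (f : ℕ → ℤ) → sumTo (suc n) f ≡ f 0 + sumTo n (λ i → f (suc i))
sumTo-suc zero    f = refl
sumTo-suc (suc n) f rewrite sumTo-suc n f = ℤ.+-assoc (f 0) (sumTo n (λ i → f (suc i))) (f (suc (suc n)))

sumTo-zero : ∀ n (f : ℕ → ℤ) → (∀ i → i ≤ n → f i ≡ + 0) → sumTo n f ≡ + 0
sumTo-zero zero    f f≗0 = f≗0 0 z≤n
sumTo-zero (suc n) f f≗0 =
  cong₂ _+_ (sumTo-zero n f (λ i i≤n → f≗0 i (m≤n⇒m≤1+n i≤n))) (f≗0 (suc n) ≤-refl)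

sumTo-∣ : ∀ {d} n (f : ℕ → ℤ) → (∀ i → i ≤ n → d Signed.∣ f i) → d Signed.∣ sumTo n f
sumTo-∣ zero    f d∣f = d∣f 0 z≤n
sumTo-∣ (suc n) f d∣f =
  Signed.∣m∣n⇒∣m+n (sumTo-∣ n f (λ i i≤n → d∣f i (m≤n⇒m≤1+n i≤n))) (d∣f (suc n) ≤-refl)

egfMul-cong : ∀ {f f′ g g′ : EGF} → (∀ j → f j ≡ f′ j) → (∀ j → g j ≡ g′ j) →
              ∀ n → egfMul f g n ≡ egfMul f′ g′ n
egfMul-cong f≗f′ g≗g′ n =
  sumTo-cong n (λ i _ → cong₂ (λ x y → + (n C i) · (x · y)) (f≗f′ i) (g≗g′ (n ℕ.∸ i)))

egfOne-∸ : ∀ {i n} → i ℕ.< n → egfOne (n ℕ.∸ i) ≡ + 0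
egfOne-∸ {zero}  {suc n} _         = refl
egfOne-∸ {suc i} {suc n} (s≤s i<n) = egfOne-∸ i<n

egfMul-identityˡ : ∀ (f : EGF) n → egfMul egfOne f n ≡ f n
egfMul-identityˡ f zero    = trans (ℤ.*-identityˡ _) (ℤ.*-identityˡ (f 0))
egfMul-identityˡ f (suc n) = begin
  egfMul egfOne f (suc n)
    ≡⟨ sumTo-suc n _ ⟩
  + 1 · (+ 1 · f (suc n)) + sumTo n (λ i → + (suc n C suc i) · (+ 0 · f (n ℕ.∸ i)))
    ≡⟨ cong₂ _+_ (trans (ℤ.*-identityˡ _) (ℤ.*-identityˡ (f (suc n))))
                 (sumTo-zero n _ (λ i _ → ℤ.*-zeroʳ (+ (suc n C suc i)))) ⟩
  f (suc n) + + 0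
    ≡⟨ ℤ.+-identityʳ (f (suc n)) ⟩
  f (suc n) ∎
  where open ≡-Reasoning

egfMul-identityʳ : ∀ (f : EGF) n → egfMul f egfOne n ≡ f n
egfMul-identityʳ f zero    = trans (ℤ.*-identityˡ _) (ℤ.*-identityʳ (f 0))
egfMul-identityʳ f (suc n) = begin
  sumTo n term + term (suc n)
    ≡⟨ cong (_+ term (suc n)) (sumTo-zero n term early-term-vanishes) ⟩
  + 0 + term (suc n)
    ≡⟨ ℤ.+-identityˡ (term (suc n)) ⟩
  + (suc n C suc n) · (f (suc n) · egfOne (n ℕ.∸ n))
    ≡⟨ cong₂ (λ c m → + c · (f (suc n) · egfOne m)) (nCn≡1 (suc n)) (n∸n≡0 n) ⟩
  + 1 · (f (suc n) · + 1)
    ≡⟨ trans (ℤ.*-identityˡ _) (ℤ.*-identityʳ (f (suc n))) ⟩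
  f (suc n) ∎
  where
  open ≡-Reasoning
  term : ℕ → ℤ
  term i = + (suc n C i) · (f i · egfOne (suc n ℕ.∸ i))
  early-term-vanishes : ∀ i → i ≤ n → term i ≡ + 0
  early-term-vanishes i i≤n = begin
    term i                          ≡⟨ cong (λ x → + (suc n C i) · (f i · x)) (egfOne-∸ (s≤s i≤n)) ⟩
    + (suc n C i) · (f i · + 0)     ≡⟨ cong (+ (suc n C i) ·_) (ℤ.*-zeroʳ (f i)) ⟩
    + (suc n C i) · + 0             ≡⟨ ℤ.*-zeroʳ (+ (suc n C i)) ⟩
    + 0                             ∎

egfDeriv : EGF → EGF
egfDeriv f i = f (suc i)

egfMul-egfDerivʳ : ∀ (f g : EGF) n →
  egfMul f (egfDeriv g) n ≡
  + 1 · (f 0 · g (suc n)) + sumTo n (λ i → + (n C suc i) · (f (suc i) · g (n ℕ.∸ i)))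
egfMul-egfDerivʳ f g n = begin
  sumTo n term                                  ≡⟨ ℤ.+-identityʳ (sumTo n term) ⟨
  sumTo n term + + 0                            ≡⟨ cong (_+_ (sumTo n term)) (sym last-term-vanishes) ⟩
  sumTo (suc n) term                            ≡⟨ sumTo-suc n term ⟩
  term 0 + sumTo n (λ i → term (suc i))         ≡⟨ cong (_+_ (term 0)) (sumTo-cong n shifted-term) ⟩
  term 0 + sumTo n upper                        ∎
  where
  open ≡-Reasoning
  term upper : ℕ → ℤ
  term i = + (n C i) · (f i · g (suc (n ℕ.∸ i)))
  upper i = + (n C suc i) · (f (suc i) · g (n ℕ.∸ i))
  last-term-vanishes : term (suc n) ≡ + 0
  last-term-vanishes rewrite k>n⇒nCk≡0 (n<1+n n) = refl
  shifted-term : ∀ i → i ≤ n → term (suc i) ≡ upper i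
  shifted-term i i≤n with m≤n⇒m<n∨m≡n i≤n
  ... | inj₁ i<n  = cong (λ m → + (n C suc i) · (f (suc i) · g m)) (sym (+-∸-assoc 1 i<n))
  ... | inj₂ refl rewrite k>n⇒nCk≡0 (n<1+n n) = refl

egfMul-leibniz : ∀ (f g : EGF) n → egfMul f g (suc n) ≡ egfMul (egfDeriv f) g n + egfMul f (egfDeriv g) n
egfMul-leibniz f g n = begin
  egfMul f g (suc n)
    ≡⟨ sumTo-suc n _ ⟩
  first + sumTo n (λ i → + (suc n C suc i) · (f (suc i) · g (n ℕ.∸ i)))
    ≡⟨ cong (_+_ first) (trans (sumTo-cong n (λ i _ → pascal i)) (sumTo-+ n _ upper)) ⟩
  first + (egfMul (egfDeriv f) g n + sumTo n upper)
    ≡⟨ exchange first (egfMul (egfDeriv f) g n) (sumTo n upper) ⟩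
  egfMul (egfDeriv f) g n + (first + sumTo n upper)
    ≡⟨ cong (_+_ (egfMul (egfDeriv f) g n)) (egfMul-egfDerivʳ f g n) ⟨
  egfMul (egfDeriv f) g n + egfMul f (egfDeriv g) n ∎
  where
  open ≡-Reasoning
  first : ℤ
  first = + 1 · (f 0 · g (suc n))
  upper : ℕ → ℤ
  upper i = + (n C suc i) · (f (suc i) · g (n ℕ.∸ i))
  pascal : ∀ i → + (suc n C suc i) · (f (suc i) · g (n ℕ.∸ i)) ≡
                 + (n C i) · (f (suc i) · g (n ℕ.∸ i)) + upper i
  pascal i = begin
    + (suc n C suc i) · x                 ≡⟨ cong (λ c → + c · x) (nCk+nC[k+1]≡[n+1]C[k+1] n i) ⟨
    + (n C i ℕ.+ n C suc i) · x           ≡⟨ cong (_· x) (ℤ.pos-+ (n C i) (n C suc i)) ⟩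
    (+ (n C i) + + (n C suc i)) · x       ≡⟨ ℤ.*-distribʳ-+ x (+ (n C i)) (+ (n C suc i)) ⟩
    + (n C i) · x + + (n C suc i) · x     ∎
    where x = f (suc i) · g (n ℕ.∸ i)
  exchange : ∀ a b c → a + (b + c) ≡ b + (a + c)
  exchange = solve-∀

egfShift : ℕ → EGF → EGF
egfShift a f i = f (i ℕ.+ a)

egfDeriv-egfShift : ∀ a (f : EGF) j → egfDeriv (egfShift a f) j ≡ egfShift (suc a) f j
egfDeriv-egfShift a f j = cong f (sym (+-suc j a))

cosE-addition : ∀ a b → cosE a · cosE (suc b) + cosE (suc a) · cosE b ≡ cosE (suc (a ℕ.+ b))
cosE-addition zero          b =
  trans (cong₂ _+_ (ℤ.*-identityˡ (cosE (suc b))) (ℤ.*-zeroˡ (cosE b))) (ℤ.+-identityʳ (cosE (suc b)))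
cosE-addition (suc zero)    b =
  trans (cong₂ _+_ (ℤ.*-zeroˡ (cosE (suc b))) (ℤ.-1*i≡-i (cosE b))) (ℤ.+-identityˡ (- cosE b))
cosE-addition (suc (suc a)) b =
  trans (negate (cosE a) (cosE (suc b)) (cosE (suc a)) (cosE b)) (cong -_ (cosE-addition a b))
  where
  negate : ∀ p x q y → (- p) · x + (- q) · y ≡ - (p · x + q · y)
  negate = solve-∀

-- egfShift a cosE is cos(x + aπ/2); this is the product-to-sum formula for cosines.
cosE-shift-product : ∀ m a b →
  egfMul (egfShift a cosE) (egfShift b cosE) (suc m) ≡ ((+ 2) ^ m) · cosE (suc m ℕ.+ (a ℕ.+ b))
cosE-shift-product zero a b = begin
  + 1 · (cosE a · cosE (suc b)) + + 1 · (cosE (suc a) · cosE b)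
    ≡⟨ cong₂ _+_ (ℤ.*-identityˡ (cosE a · cosE (suc b))) (ℤ.*-identityˡ (cosE (suc a) · cosE b)) ⟩
  cosE a · cosE (suc b) + cosE (suc a) · cosE b
    ≡⟨ cosE-addition a b ⟩
  cosE (suc (a ℕ.+ b))
    ≡⟨ ℤ.*-identityˡ (cosE (suc (a ℕ.+ b))) ⟨
  + 1 · cosE (suc (a ℕ.+ b)) ∎
  where open ≡-Reasoning
cosE-shift-product (suc m) a b = begin
  egfMul (egfShift a cosE) (egfShift b cosE) (suc (suc m))
    ≡⟨ egfMul-leibniz (egfShift a cosE) (egfShift b cosE) (suc m) ⟩
  egfMul (egfDeriv (egfShift a cosE)) (egfShift b cosE) (suc m) +
  egfMul (egfShift a cosE) (egfDeriv (egfShift b cosE)) (suc m)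
    ≡⟨ cong₂ _+_ (egfMul-cong {g = egfShift b cosE} (egfDeriv-egfShift a cosE) (λ _ → refl) (suc m))
                 (egfMul-cong {f = egfShift a cosE} (λ _ → refl) (egfDeriv-egfShift b cosE) (suc m)) ⟩
  egfMul (egfShift (suc a) cosE) (egfShift b cosE) (suc m) +
  egfMul (egfShift a cosE) (egfShift (suc b) cosE) (suc m)
    ≡⟨ cong₂ _+_ (cosE-shift-product m (suc a) b) (cosE-shift-product m a (suc b)) ⟩
  ((+ 2) ^ m) · cosE (suc m ℕ.+ (suc a ℕ.+ b)) + ((+ 2) ^ m) · cosE (suc m ℕ.+ (a ℕ.+ suc b))
    ≡⟨ cong₂ (λ k l → ((+ 2) ^ m) · cosE (suc k) + ((+ 2) ^ m) · cosE (suc l))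
             (+-suc m (a ℕ.+ b)) (trans (cong (m ℕ.+_) (+-suc a b)) (+-suc m (a ℕ.+ b))) ⟩
  ((+ 2) ^ m) · cosE (suc (suc m) ℕ.+ (a ℕ.+ b)) + ((+ 2) ^ m) · cosE (suc (suc m) ℕ.+ (a ℕ.+ b))
    ≡⟨ double ((+ 2) ^ m) (cosE (suc (suc m) ℕ.+ (a ℕ.+ b))) ⟩
  ((+ 2) ^ suc m) · cosE (suc (suc m) ℕ.+ (a ℕ.+ b)) ∎
  where
  open ≡-Reasoning
  double : ∀ p x → p · x + p · x ≡ (+ 2 · p) · x
  double = solve-∀

cosE-square : ∀ m → egfMul cosE cosE (suc m) ≡ ((+ 2) ^ m) · cosE (suc m)
cosE-square m = begin
  egfMul cosE cosE (suc m)
    ≡⟨ egfMul-cong unshift unshift (suc m) ⟩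
  egfMul (egfShift 0 cosE) (egfShift 0 cosE) (suc m)
    ≡⟨ cosE-shift-product m 0 0 ⟩
  ((+ 2) ^ m) · cosE (suc (m ℕ.+ 0))
    ≡⟨ cong (λ k → ((+ 2) ^ m) · cosE (suc k)) (+-identityʳ m) ⟩
  ((+ 2) ^ m) · cosE (suc m) ∎
  where
  open ≡-Reasoning
  unshift : ∀ j → cosE j ≡ egfShift 0 cosE j
  unshift j = cong cosE (sym (+-identityʳ j))

sin2sq-cosE : ∀ j → sin2sq j ≡ + 2 · egfOne j - + 2 · cosE j
sin2sq-cosE zero    = refl
sin2sq-cosE (suc j) = sym (ℤ.+-identityˡ (- (+ 2 · cosE (suc j))))

sin2sq-square : ∀ n →
  egfMul sin2sq sin2sq n ≡ + 4 · ((egfOne n + egfMul cosE cosE n) - (cosE n + cosE n))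
sin2sq-square n = begin
  egfMul sin2sq sin2sq n
    ≡⟨ sumTo-cong n (λ i _ → expand i) ⟩
  sumTo n (λ i → + 4 · ((term egfOne egfOne i + term cosE cosE i) - (term egfOne cosE i + term cosE egfOne i)))
    ≡⟨ sumTo-*ˡ n (+ 4) _ ⟩
  + 4 · sumTo n (λ i → (term egfOne egfOne i + term cosE cosE i) - (term egfOne cosE i + term cosE egfOne i))
    ≡⟨ cong (+ 4 ·_) (trans (sumTo-- n _ _) (cong₂ _-_ (sumTo-+ n _ _) (sumTo-+ n _ _))) ⟩
  + 4 · ((egfMul egfOne egfOne n + egfMul cosE cosE n) - (egfMul egfOne cosE n + egfMul cosE egfOne n))
    ≡⟨ cong₂ (λ x y → + 4 · ((x + egfMul cosE cosE n) - y))
             (egfMul-identityˡ egfOne n) (cong₂ _+_ (egfMul-identityˡ cosE n) (egfMul-identityʳ cosE n)) ⟩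
  + 4 · ((egfOne n + egfMul cosE cosE n) - (cosE n + cosE n)) ∎
  where
  open ≡-Reasoning
  term : EGF → EGF → ℕ → ℤ
  term f g i = + (n C i) · (f i · g (n ℕ.∸ i))
  bilinear : ∀ b d c d′ c′ → b · ((+ 2 · d - + 2 · c) · (+ 2 · d′ - + 2 · c′)) ≡
             + 4 · ((b · (d · d′) + b · (c · c′)) - (b · (d · c′) + b · (c · d′)))
  bilinear = solve-∀
  expand : ∀ i → term sin2sq sin2sq i ≡
    + 4 · ((term egfOne egfOne i + term cosE cosE i) - (term egfOne cosE i + term cosE egfOne i))
  expand i = trans (cong₂ (λ x y → + (n C i) · (x · y)) (sin2sq-cosE i) (sin2sq-cosE (n ℕ.∸ i)))
                   (bilinear (+ (n C i)) (egfOne i) (cosE i) (egfOne (n ℕ.∸ i)) (cosE (n ℕ.∸ i)))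

sin2sq-square-suc : ∀ m → egfMul sin2sq sin2sq (suc m) ≡ + 4 · (((+ 2) ^ m - + 2) · cosE (suc m))
sin2sq-square-suc m = begin
  egfMul sin2sq sin2sq (suc m)
    ≡⟨ sin2sq-square (suc m) ⟩
  + 4 · ((+ 0 + egfMul cosE cosE (suc m)) - (cosE (suc m) + cosE (suc m)))
    ≡⟨ cong (λ y → + 4 · ((+ 0 + y) - (cosE (suc m) + cosE (suc m)))) (cosE-square m) ⟩
  + 4 · ((+ 0 + (+ 2) ^ m · cosE (suc m)) - (cosE (suc m) + cosE (suc m)))
    ≡⟨ collect ((+ 2) ^ m) (cosE (suc m)) ⟩
  + 4 · (((+ 2) ^ m - + 2) · cosE (suc m)) ∎
  where
  open ≡-Reasoning
  collect : ∀ p x → + 4 · ((+ 0 + p · x) - (x + x)) ≡ + 4 · ((p - + 2) · x)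
  collect = solve-∀

egfMul-∣ʳ : ∀ {d} (f g : EGF) → (∀ j → d Signed.∣ g j) → ∀ n → d Signed.∣ egfMul f g n
egfMul-∣ʳ f g d∣g n =
  sumTo-∣ n _ (λ i _ → Signed.∣n⇒∣m*n (+ (n C i)) (Signed.∣n⇒∣m*n (f i) (d∣g (n ℕ.∸ i))))

3∣[2^m-2]·cosE[1+m] : ∀ m → + 3 Signed.∣ ((+ 2) ^ m - + 2) · cosE (suc m)
3∣[2^m-2]·cosE[1+m] zero          = Signed.divides (+ 0) refl
3∣[2^m-2]·cosE[1+m] (suc zero)    = Signed.divides (+ 0) refl
3∣[2^m-2]·cosE[1+m] (suc (suc m)) =
  subst (+ 3 Signed.∣_) (sym (recurrence ((+ 2) ^ m) (cosE (suc m))))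
    (Signed.∣m∣n⇒∣m-n (Signed.∣n⇒∣m*n (- + 4) (3∣[2^m-2]·cosE[1+m] m))
                      (Signed.∣m⇒∣m*n (+ 2 · cosE (suc m)) Signed.∣-refl))
  where
  recurrence : ∀ p x → (+ 2 · (+ 2 · p) - + 2) · (- x) ≡ (- + 4) · ((p - + 2) · x) - + 3 · (+ 2 · x)
  recurrence = solve-∀

6∣sin2sq² : ∀ n → + 6 Signed.∣ egfMul sin2sq sin2sq n
6∣sin2sq² zero    = Signed.divides (+ 0) refl
6∣sin2sq² (suc m) =
  subst (+ 6 Signed.∣_) (trans (sym (ℤ.*-assoc (+ 2) (+ 2) g)) (sym (sin2sq-square-suc m)))
    (Signed.∣n⇒∣m*n (+ 2) (Signed.*-monoʳ-∣ (+ 2) (3∣[2^m-2]·cosE[1+m] m)))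
  where
  g : ℤ
  g = ((+ 2) ^ m - + 2) · cosE (suc m)

6∣sin2sq^[2+m] : ∀ m n → + 6 Signed.∣ egfPow sin2sq (2 ℕ.+ m) n
6∣sin2sq^[2+m] zero    n =
  subst (+ 6 Signed.∣_)
    (egfMul-cong {f = sin2sq} (λ _ → refl) (λ j → sym (egfMul-identityʳ sin2sq j)) n)
    (6∣sin2sq² n)
6∣sin2sq^[2+m] (suc m) n = egfMul-∣ʳ sin2sq _ (6∣sin2sq^[2+m] m) n

6∣summand : ∀ k j m → + 6 Signed.∣ (+ (2 * m ℕ.+ 1)) ^ suc k · egfPow sin2sq m (suc j)
6∣summand k j zero                = Signed.∣n⇒∣m*n ((+ 1) ^ suc k) (Signed.divides (+ 0) refl)
6∣summand k j (suc zero)          = Signed.divides (- ((+ 3) ^ k · cosE (suc j))) (begin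
  (+ 3) ^ suc k · egfMul sin2sq egfOne (suc j)
    ≡⟨ cong ((+ 3) ^ suc k ·_) (egfMul-identityʳ sin2sq (suc j)) ⟩
  (+ 3 · (+ 3) ^ k) · - (+ 2 · cosE (suc j))
    ≡⟨ factor ((+ 3) ^ k) (cosE (suc j)) ⟩
  - ((+ 3) ^ k · cosE (suc j)) · + 6 ∎)
  where
  open ≡-Reasoning
  factor : ∀ p x → (+ 3 · p) · - (+ 2 · x) ≡ - (p · x) · + 6
  factor = solve-∀
6∣summand k j (suc (suc m))       =
  Signed.∣n⇒∣m*n ((+ (2 * suc (suc m) ℕ.+ 1)) ^ suc k) (6∣sin2sq^[2+m] m (suc j))

6∣polyBernoulli2Neg[1+n] : ∀ n k → + 6 Signed.∣ polyBernoulli2Neg (suc n) (suc k)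
6∣polyBernoulli2Neg[1+n] n k = sumTo-∣ (suc n) _ (λ m _ → 6∣summand k n m)

theorem11 : (n k : ℕ) → 1 ≤ n → 1 ≤ k → (+ 6) ∣ polyBernoulli2Neg (2 * n) k
theorem11 (suc n) (suc k) _ _ =
  Signed.∣⇒∣ᵤ (6∣polyBernoulli2Neg[1+n] (ℕ.pred (2 * suc n)) k)
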